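{- For every set $A$, $A_{tt}\leq_1 A^{b_0}$.
   Context: Let $\varphi_0,\varphi_1,\dots$ be an acceptable enumeration of the partial computable functions and $\Phi_0,\Phi_1,\dots$ an acceptable enumeration of the Turing functionals; $\langle\cdot,\cdot,\cdot\rangle$ is a computable bijective coding of triples. For a set $A$, $A\upharpoonright x=\{n\in A:n\leq x\}$. $A^{b_0}=\{\langle e,i,j\rangle: \varphi_i(j)\downarrow\wedge\Phi_e^{A\upharpoonright\varphi_i(j)}(j)\downarrow\}$. A $tt$-condition is a finite sequence $x_1,\dots,x_k\in\mathbb{N}$ together with a function $\alpha:2^k\to 2$ (tt-conditions are coded by natural numbers in a canonical effective way); it is satisfied by $A$ if $\alpha(A(x_1),\dots,A(x_k))=1$. $A^{tt}$ is the set of (codes of) tt-conditions satisfied by $A$, and $A_{tt}=\{x:\varphi_x(x)\downarrow\in A^{tt}\}$. $\leq_1$ is 1-reducibility. -}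

module Defs where

open import Data.Nat using (ℕ; zero; suc; _+_; _*_; _≤ᵇ_)
open import Data.Bool using (Bool; true; false; if_then_else_)
open import Data.List using (List; []; _∷_)
open import Data.Maybe using (Maybe; just; nothing; _>>=_)
open import Data.Product using (Σ; _×_; _,_; ∃; ∃-syntax)
open import Relation.Binary.PropositionalEquality using (_≡_)
open import Function.Definitions using (Injective)

Set⊆ℕ : Set
Set⊆ℕ = ℕ → Bool

_↾_ : Set⊆ℕ → ℕ → Set⊆ℕ
(A ↾ x) n = if n ≤ᵇ x then A n else false

tri : ℕ → ℕ
tri zero = 0
tri (suc d) = tri d + suc d

pair : ℕ → ℕ → ℕ
pair a b = tri (a + b) + b

-- enumerates (0,0),(1,0),(0,1),(2,0),(1,1),(0,2),... ; inverse of pair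
unpair : ℕ → ℕ × ℕ
unpair zero = 0 , 0
unpair (suc n) with unpair n
... | zero , b = suc b , 0
... | suc a , b = a , suc b

triple : ℕ → ℕ → ℕ → ℕ
triple e i j = pair e (pair i j)

data Code : Set where
  zer  : Code
  sc   : Code
  proj : ℕ → Code             -- i-th argument (0 if absent)
  comp : Code → List Code → Code
  prec : Code → Code → Code
  mu   : Code → Code
  orc  : Code

-- decoding with fuel (fuel suc n suffices for the number n)
mutual
  decodeF : ℕ → ℕ → Code
  decodeF zero _ = zer
  decodeF (suc k) zero = zer
  decodeF (suc k) (suc m) with unpair m
  ... | 0 , r = sc
  ... | 1 , r = proj r
  ... | 2 , r with unpair r
  ...   | a , b = comp (decodeF k a) (decodeListF k b)
  decodeF (suc k) (suc m) | 3 , r with unpair r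
  ...   | a , b = prec (decodeF k a) (decodeF k b)
  decodeF (suc k) (suc m) | 4 , r = mu (decodeF k r)
  decodeF (suc k) (suc m) | 5 , r = orc
  decodeF (suc k) (suc m) | _ , r = zer

  decodeListF : ℕ → ℕ → List Code
  decodeListF zero _ = []
  decodeListF (suc k) zero = []
  decodeListF (suc k) (suc m) with unpair m
  ... | a , b = decodeF k a ∷ decodeListF k b

decode : ℕ → Code
decode n = decodeF (suc n) n

headℕ : List ℕ → ℕ
headℕ [] = 0
headℕ (x ∷ _) = x

nth : ℕ → List ℕ → ℕ
nth _ [] = 0
nth zero (x ∷ _) = x
nth (suc i) (_ ∷ xs) = nth i xs

mutual
  eval : ℕ → Set⊆ℕ → Code → List ℕ → Maybe ℕ
  eval zero O c xs = nothing
  eval (suc k) O zer xs = just 0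
  eval (suc k) O sc xs = just (suc (headℕ xs))
  eval (suc k) O (proj i) xs = just (nth i xs)
  eval (suc k) O (comp f gs) xs = evalList k O gs xs >>= λ ys → eval k O f ys
  eval (suc k) O (prec f g) [] = eval k O f []
  eval (suc k) O (prec f g) (zero ∷ xs) = eval k O f xs
  eval (suc k) O (prec f g) (suc n ∷ xs) =
    eval k O (prec f g) (n ∷ xs) >>= λ r → eval k O g (n ∷ r ∷ xs)
  eval (suc k) O (mu f) xs = search k O f xs 0
  eval (suc k) O orc xs = just (if O (headℕ xs) then 1 else 0)

  evalList : ℕ → Set⊆ℕ → List Code → List ℕ → Maybe (List ℕ)
  evalList k O [] xs = just []
  evalList zero O (g ∷ gs) xs = nothing
  evalList (suc k) O (g ∷ gs) xs =
    eval k O g xs >>= λ y → evalList k O gs xs >>= λ ys → just (y ∷ ys)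

  search : ℕ → Set⊆ℕ → Code → List ℕ → ℕ → Maybe ℕ
  search zero O f xs n = nothing
  search (suc k) O f xs n with eval k O f (n ∷ xs)
  ... | nothing = nothing
  ... | just zero = just n
  ... | just (suc _) = search k O f xs (suc n)

emptyOracle : Set⊆ℕ
emptyOracle _ = false

Φ⟨_⟩^_⟨_⟩↓=_ : ℕ → Set⊆ℕ → ℕ → ℕ → Set
Φ⟨ e ⟩^ B ⟨ x ⟩↓= y = ∃[ k ] eval k B (decode e) (x ∷ []) ≡ just y

Φ⟨_⟩^_⟨_⟩↓ : ℕ → Set⊆ℕ → ℕ → Set
Φ⟨ e ⟩^ B ⟨ x ⟩↓ = ∃[ y ] Φ⟨ e ⟩^ B ⟨ x ⟩↓= y

φ⟨_⟩⟨_⟩↓=_ : ℕ → ℕ → ℕ → Set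
φ⟨ e ⟩⟨ x ⟩↓= y = Φ⟨ e ⟩^ emptyOracle ⟨ x ⟩↓= y

decodeNatListF : ℕ → ℕ → List ℕ
decodeNatListF zero _ = []
decodeNatListF (suc k) zero = []
decodeNatListF (suc k) (suc m) with unpair m
... | a , b = a ∷ decodeNatListF k b

decodeNatList : ℕ → List ℕ
decodeNatList n = decodeNatListF (suc n) n

half : ℕ → ℕ
half zero = 0
half (suc zero) = 0
half (suc (suc n)) = suc (half n)

odd : ℕ → Bool
odd zero = false
odd (suc zero) = true
odd (suc (suc n)) = odd n

bit : ℕ → ℕ → Bool
bit b zero = odd b
bit b (suc i) = bit (half b) i

rowIndex : Set⊆ℕ → List ℕ → ℕ
rowIndex A [] = 0
rowIndex A (x ∷ xs) = (if A x then 1 else 0) + 2 * rowIndex A xs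

-- A tt-condition is coded by pair l t, where l codes the list x₁,…,x_k
-- and the truth table α : 2^k → 2 is given by the binary digits of t:
-- α(σ) = bit number (index of σ) of t.
SatTT : Set⊆ℕ → ℕ → Bool
SatTT A c with unpair c
... | l , t = bit t (rowIndex A (decodeNatList l))

_^tt : Set⊆ℕ → ℕ → Set
(A ^tt) c = SatTT A c ≡ true

_ₜₜ : Set⊆ℕ → ℕ → Set
(A ₜₜ) x = ∃[ y ] (φ⟨ x ⟩⟨ x ⟩↓= y × (A ^tt) y)

_^b₀ : Set⊆ℕ → ℕ → Set
(A ^b₀) n = ∃[ e ] ∃[ i ] ∃[ j ] (n ≡ triple e i j ×
              ∃[ v ] (φ⟨ i ⟩⟨ j ⟩↓= v × Φ⟨ e ⟩^ (A ↾ v) ⟨ j ⟩↓))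

Computable : (ℕ → ℕ) → Set
Computable f = ∃[ e ] (∀ x → φ⟨ e ⟩⟨ x ⟩↓= f x)

_≤₁_ : (ℕ → Set) → (ℕ → Set) → Set
P ≤₁ Q = ∃[ f ] (Computable f × Injective _≡_ _≡_ f ×
                 (∀ x → (P x → Q (f x)) × (Q (f x) → P x)))

module Submission where

-- Given x, let σₓ be the program coded by x with every oracle query replaced by the constant 0: relative to
-- any oracle it computes φₓ.  Let Evaluator be the oracle program that halts on input c exactly when the
-- oracle satisfies the tt-condition c (a minimisation over the constant 1 ∸ [oracle satisfies c]).  The
-- reduction sends x to ⟨eₓ, x, x⟩, where eₓ codes the composition Evaluator ∘ σₓ.  If φₓ(x) = v then
-- Φ_{eₓ}^{A↾v}(x) halts iff A ↾ v satisfies v, iff A satisfies v, because the condition v only asks about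
-- numbers below v; so x ∈ A_tt iff ⟨eₓ, x, x⟩ ∈ A^{b₀}.  The reduction is injective by injectivity of pairing.

open import Defs
open import Data.Nat using (ℕ; zero; suc; _+_; _*_; _∸_; _≤_; _<_; z≤n; s≤s; _⊔_; _≡ᵇ_; _≤′_; ≤′-refl; ≤′-step)
open import Data.Nat.Properties
open import Data.Nat.Tactic.RingSolver using (solve-∀)
open import Data.Bool using (Bool; true; false; if_then_else_; not)
open import Data.Bool.Properties using (T-≡)
open import Data.List using (List; []; _∷_; map)
open import Data.Maybe using (Maybe; just; nothing; _>>=_)
open import Data.Product using (_×_; _,_; ∃-syntax; proj₁; proj₂)
open import Data.Sum using (inj₁; inj₂)
open import Data.Empty using (⊥; ⊥-elim)
open import Function using (_$_)
open import Function.Bundles using (Equivalence)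
open import Function.Definitions using (Injective)
open import Relation.Binary.PropositionalEquality
open ≡-Reasoning

unpair-suc-edge : ∀ n b → unpair n ≡ (0 , b) → unpair (suc n) ≡ (suc b , 0)
unpair-suc-edge n b eq rewrite eq = refl

unpair-suc-step : ∀ n a b → unpair n ≡ (suc a , b) → unpair (suc n) ≡ (a , suc b)
unpair-suc-step n a b eq rewrite eq = refl

unpair-diagonal : ∀ d b a → a + b ≡ d → unpair (tri d + b) ≡ (a , b)
unpair-diagonal zero zero zero eq = refl
unpair-diagonal (suc d) zero a eq
  rewrite +-identityʳ (tri d + suc d) | +-suc (tri d) d
        | unpair-suc-edge (tri d + d) d (unpair-diagonal d d 0 refl)
  = cong (_, 0) (trans (sym eq) (+-identityʳ a))
unpair-diagonal d (suc b) a eq rewrite +-suc (tri d) b =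
  unpair-suc-step (tri d + b) a b (unpair-diagonal d b (suc a) (trans (sym (+-suc a b)) eq))

unpair-pair : ∀ a b → unpair (pair a b) ≡ (a , b)
unpair-pair a b = unpair-diagonal (a + b) b a refl

pair-unpair : ∀ m {a b} → unpair m ≡ (a , b) → pair a b ≡ m
pair-unpair zero refl = refl
pair-unpair (suc m) {a} {b} eq with unpair m in e
... | zero , b' with eq
... | refl rewrite +-identityʳ b' | +-identityʳ (tri b' + suc b') | +-suc (tri b') b' =
  cong suc (pair-unpair m e)
pair-unpair (suc m) {a} {b} eq | suc a' , b' with eq
... | refl rewrite +-suc a b' | +-suc (tri (suc (a + b'))) b' = cong suc (pair-unpair m e)

pair-injective : ∀ {a b a' b'} → pair a b ≡ pair a' b' → (a ≡ a') × (b ≡ b')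
pair-injective {a} {b} {a'} {b'} eq
  with trans (sym (unpair-pair a b)) (trans (cong unpair eq) (unpair-pair a' b'))
... | refl = refl , refl

triple-injective : ∀ {e i j e' i' j'} → triple e i j ≡ triple e' i' j' → (e ≡ e') × (i ≡ i') × (j ≡ j')
triple-injective {e} {i} {j} {e'} {i'} {j'} eq with pair-injective {e} {pair i j} {e'} {pair i' j'} eq
... | refl , eq' with pair-injective {i} {j} {i'} {j'} eq'
... | refl , refl = refl , refl , refl

tri-mono : ∀ {d e} → d ≤ e → tri d ≤ tri e
tri-mono {zero} _ = z≤n
tri-mono {suc d} {suc e} (s≤s p) = +-mono-≤ (tri-mono p) (s≤s p)

pair-mono : ∀ {a a' b b'} → a ≤ a' → b ≤ b' → pair a b ≤ pair a' b'
pair-mono p q = +-mono-≤ (tri-mono (+-mono-≤ p q)) q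

-- Both components are bounded by the pair, since d ≤ tri d.
pair-≥ˡ : ∀ a b → a ≤ pair a b
pair-≥ˡ a b = ≤-trans (m≤m+n a b) (≤-trans (tri-≥ (a + b)) (m≤m+n _ b))
  where
  tri-≥ : ∀ d → d ≤ tri d
  tri-≥ zero = z≤n
  tri-≥ (suc d) = m≤n+m (suc d) (tri d)

pair-≥ʳ : ∀ a b → b ≤ pair a b
pair-≥ʳ a b = m≤n+m b (tri (a + b))

unpair₁ unpair₂ : ℕ → ℕ
unpair₁ n = proj₁ (unpair n)
unpair₂ n = proj₂ (unpair n)

unpair-≤ˡ : ∀ m {a b} → unpair m ≡ (a , b) → a ≤ m
unpair-≤ˡ m {a} {b} eq = subst (a ≤_) (pair-unpair m eq) (pair-≥ˡ a b)

unpair-≤ʳ : ∀ m {a b} → unpair m ≡ (a , b) → b ≤ m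
unpair-≤ʳ m {a} {b} eq = subst (b ≤_) (pair-unpair m eq) (pair-≥ʳ a b)

<-pairˡ : ∀ a b {k} → pair a b < k → a < k
<-pairˡ a b = ≤-<-trans (pair-≥ˡ a b)

<-pairʳ : ∀ a b {k} → pair a b < k → b < k
<-pairʳ a b = ≤-<-trans (pair-≥ʳ a b)

<-unpairˡ : ∀ {m a b k} → unpair m ≡ (a , b) → m < k → a < k
<-unpairˡ {m} eq = ≤-<-trans (unpair-≤ˡ m eq)

<-unpairʳ : ∀ {m a b k} → unpair m ≡ (a , b) → m < k → b < k
<-unpairʳ {m} eq = ≤-<-trans (unpair-≤ʳ m eq)

mutual
  ⌜_⌝ : Code → ℕ
  ⌜ zer ⌝ = 0
  ⌜ sc ⌝ = suc (pair 0 0)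
  ⌜ proj i ⌝ = suc (pair 1 i)
  ⌜ comp f gs ⌝ = suc (pair 2 (pair ⌜ f ⌝ ⌜ gs ⌝*))
  ⌜ prec f g ⌝ = suc (pair 3 (pair ⌜ f ⌝ ⌜ g ⌝))
  ⌜ mu f ⌝ = suc (pair 4 ⌜ f ⌝)
  ⌜ orc ⌝ = suc (pair 5 0)

  ⌜_⌝* : List Code → ℕ
  ⌜ [] ⌝* = 0
  ⌜ g ∷ gs ⌝* = suc (pair ⌜ g ⌝ ⌜ gs ⌝*)

mutual
  decodeF-⌜⌝ : ∀ k c → ⌜ c ⌝ < k → decodeF k ⌜ c ⌝ ≡ c
  decodeF-⌜⌝ (suc k) zer p = refl
  decodeF-⌜⌝ (suc k) sc p rewrite unpair-pair 0 0 = refl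
  decodeF-⌜⌝ (suc k) (proj i) p rewrite unpair-pair 1 i = refl
  decodeF-⌜⌝ (suc k) (comp f gs) (s≤s p)
    rewrite unpair-pair 2 (pair ⌜ f ⌝ ⌜ gs ⌝*) | unpair-pair ⌜ f ⌝ ⌜ gs ⌝* =
    cong₂ comp (decodeF-⌜⌝ k f (<-pairˡ _ ⌜ gs ⌝* (<-pairʳ 2 _ p)))
               (decodeListF-⌜⌝ k gs (<-pairʳ ⌜ f ⌝ _ (<-pairʳ 2 _ p)))
  decodeF-⌜⌝ (suc k) (prec f g) (s≤s p)
    rewrite unpair-pair 3 (pair ⌜ f ⌝ ⌜ g ⌝) | unpair-pair ⌜ f ⌝ ⌜ g ⌝ =
    cong₂ prec (decodeF-⌜⌝ k f (<-pairˡ _ ⌜ g ⌝ (<-pairʳ 3 _ p)))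
               (decodeF-⌜⌝ k g (<-pairʳ ⌜ f ⌝ _ (<-pairʳ 3 _ p)))
  decodeF-⌜⌝ (suc k) (mu f) (s≤s p) rewrite unpair-pair 4 ⌜ f ⌝ =
    cong mu (decodeF-⌜⌝ k f (<-pairʳ 4 _ p))
  decodeF-⌜⌝ (suc k) orc p rewrite unpair-pair 5 0 = refl

  decodeListF-⌜⌝ : ∀ k gs → ⌜ gs ⌝* < k → decodeListF k ⌜ gs ⌝* ≡ gs
  decodeListF-⌜⌝ (suc k) [] p = refl
  decodeListF-⌜⌝ (suc k) (g ∷ gs) (s≤s p) rewrite unpair-pair ⌜ g ⌝ ⌜ gs ⌝* =
    cong₂ _∷_ (decodeF-⌜⌝ k g (<-pairˡ _ ⌜ gs ⌝* p)) (decodeListF-⌜⌝ k gs (<-pairʳ ⌜ g ⌝ _ p))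

decode-⌜⌝ : ∀ c → decode ⌜ c ⌝ ≡ c
decode-⌜⌝ c = decodeF-⌜⌝ (suc ⌜ c ⌝) c ≤-refl

mutual
  decodeF-fuel : ∀ k k' n → n < k → n < k' → decodeF k n ≡ decodeF k' n
  decodeF-fuel (suc k) (suc k') zero p q = refl
  decodeF-fuel (suc k) (suc k') (suc m) (s≤s p) (s≤s q) with unpair m in e
  ... | 0 , r = refl
  ... | 1 , r = refl
  ... | 2 , r with unpair r in e₂
  ...   | a , b = cong₂ comp (decodeF-fuel k k' a (<-unpairˡ e₂ (<-unpairʳ e p)) (<-unpairˡ e₂ (<-unpairʳ e q)))
                             (decodeListF-fuel k k' b (<-unpairʳ e₂ (<-unpairʳ e p)) (<-unpairʳ e₂ (<-unpairʳ e q)))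
  decodeF-fuel (suc k) (suc k') (suc m) (s≤s p) (s≤s q) | 3 , r with unpair r in e₂
  ...   | a , b = cong₂ prec (decodeF-fuel k k' a (<-unpairˡ e₂ (<-unpairʳ e p)) (<-unpairˡ e₂ (<-unpairʳ e q)))
                             (decodeF-fuel k k' b (<-unpairʳ e₂ (<-unpairʳ e p)) (<-unpairʳ e₂ (<-unpairʳ e q)))
  decodeF-fuel (suc k) (suc k') (suc m) (s≤s p) (s≤s q) | 4 , r =
    cong mu (decodeF-fuel k k' r (<-unpairʳ e p) (<-unpairʳ e q))
  decodeF-fuel (suc k) (suc k') (suc m) (s≤s p) (s≤s q) | 5 , r = refl
  decodeF-fuel (suc k) (suc k') (suc m) (s≤s p) (s≤s q) | suc (suc (suc (suc (suc (suc _))))) , r = refl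

  decodeListF-fuel : ∀ k k' n → n < k → n < k' → decodeListF k n ≡ decodeListF k' n
  decodeListF-fuel (suc k) (suc k') zero p q = refl
  decodeListF-fuel (suc k) (suc k') (suc m) (s≤s p) (s≤s q) with unpair m in e
  ... | a , b = cong₂ _∷_ (decodeF-fuel k k' a (<-unpairˡ e p) (<-unpairˡ e q))
                          (decodeListF-fuel k k' b (<-unpairʳ e p) (<-unpairʳ e q))

decodeListF-0 : ∀ k → decodeListF k 0 ≡ []
decodeListF-0 zero = refl
decodeListF-0 (suc k) = refl

decode-comp : ∀ k m {r a b} → unpair m ≡ (2 , r) → unpair r ≡ (a , b) →
              decodeF (suc k) (suc m) ≡ comp (decodeF k a) (decodeListF k b)
decode-comp k m e e₂ rewrite e | e₂ = refl

decode-prec : ∀ k m {r a b} → unpair m ≡ (3 , r) → unpair r ≡ (a , b) →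
              decodeF (suc k) (suc m) ≡ prec (decodeF k a) (decodeF k b)
decode-prec k m e e₂ rewrite e | e₂ = refl

decode-mu : ∀ k m {r} → unpair m ≡ (4 , r) → decodeF (suc k) (suc m) ≡ mu (decodeF k r)
decode-mu k m e rewrite e = refl

fuel-mono : {X : Set} (F : ℕ → Maybe X) → (∀ {k y} → F k ≡ just y → F (suc k) ≡ just y) →
            ∀ {k k' y} → k ≤ k' → F k ≡ just y → F k' ≡ just y
fuel-mono F step {k} {k'} {y} k≤k' Fk = go (≤⇒≤′ k≤k')
  where
  go : ∀ {n} → k ≤′ n → F n ≡ just y
  go ≤′-refl = Fk
  go (≤′-step p) = step (go p)

bind-just : ∀ {A B : Set} (m : Maybe A) (f : A → Maybe B) {y} → (m >>= f) ≡ just y →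
            ∃[ x ] (m ≡ just x × f x ≡ just y)
bind-just (just x) f eq = x , refl , eq

mutual
  eval-suc : ∀ k O c xs {y} → eval k O c xs ≡ just y → eval (suc k) O c xs ≡ just y
  eval-suc (suc k) O zer xs eq = eq
  eval-suc (suc k) O sc xs eq = eq
  eval-suc (suc k) O (proj i) xs eq = eq
  eval-suc (suc k) O (comp f gs) xs eq with bind-just (evalList k O gs xs) _ eq
  ... | ys , e₁ , e₂ rewrite evalList-suc k O gs xs e₁ = eval-suc k O f ys e₂
  eval-suc (suc k) O (prec f g) [] eq = eval-suc k O f [] eq
  eval-suc (suc k) O (prec f g) (zero ∷ xs) eq = eval-suc k O f xs eq
  eval-suc (suc k) O (prec f g) (suc n ∷ xs) eq with bind-just (eval k O (prec f g) (n ∷ xs)) _ eq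
  ... | r , e₁ , e₂ rewrite eval-suc k O (prec f g) (n ∷ xs) e₁ = eval-suc k O g (n ∷ r ∷ xs) e₂
  eval-suc (suc k) O (mu f) xs eq = search-suc k O f xs 0 eq
  eval-suc (suc k) O orc xs eq = eq

  evalList-suc : ∀ k O gs xs {ys} → evalList k O gs xs ≡ just ys → evalList (suc k) O gs xs ≡ just ys
  evalList-suc k O [] xs eq = eq
  evalList-suc (suc k) O (g ∷ gs) xs eq with bind-just (eval k O g xs) _ eq
  ... | y , e₁ , e₂ with bind-just (evalList k O gs xs) _ e₂
  ... | ys , e₃ , e₄ rewrite eval-suc k O g xs e₁ | evalList-suc k O gs xs e₃ = e₄

  search-suc : ∀ k O f xs n {y} → search k O f xs n ≡ just y → search (suc k) O f xs n ≡ just y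
  search-suc (suc k) O f xs n eq with eval k O f (n ∷ xs) in e
  ... | just zero rewrite eval-suc k O f (n ∷ xs) e = eq
  ... | just (suc _) rewrite eval-suc k O f (n ∷ xs) e = search-suc k O f xs (suc n) eq

eval-mono : ∀ O c xs {k k' y} → k ≤ k' → eval k O c xs ≡ just y → eval k' O c xs ≡ just y
eval-mono O c xs = fuel-mono (λ k → eval k O c xs) (λ {k} → eval-suc k O c xs)

evalList-mono : ∀ O gs xs {k k' ys} → k ≤ k' → evalList k O gs xs ≡ just ys → evalList k' O gs xs ≡ just ys
evalList-mono O gs xs = fuel-mono (λ k → evalList k O gs xs) (λ {k} → evalList-suc k O gs xs)

search-mono : ∀ O f xs n {k k' y} → k ≤ k' → search k O f xs n ≡ just y → search k' O f xs n ≡ just y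
search-mono O f xs n = fuel-mono (λ k → search k O f xs n) (λ {k} → search-suc k O f xs n)

-- Two terminating runs of the same program agree: run both with the larger fuel.
eval-deterministic : ∀ O c xs k k' {y y'} → eval k O c xs ≡ just y → eval k' O c xs ≡ just y' → y ≡ y'
eval-deterministic O c xs k k' e e'
  with trans (sym (eval-mono O c xs (m≤m⊔n k k') e)) (eval-mono O c xs (m≤n⊔m k k') e')
... | refl = refl

-- Convergence: with oracle O, program c on arguments xs halts with output y.  (A data type rather than
-- an existential, so that Agda can infer O, c, xs and y from a proof of convergence.)
data _⊢_⟨_⟩⇓_ (O : Set⊆ℕ) (c : Code) (xs : List ℕ) (y : ℕ) : Set where
  halts : ∀ k → eval k O c xs ≡ just y → O ⊢ c ⟨ xs ⟩⇓ y

data _⊢_⟨_⟩⇓*_ (O : Set⊆ℕ) (gs : List Code) (xs : List ℕ) (ys : List ℕ) : Set where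
  halts* : ∀ k → evalList k O gs xs ≡ just ys → O ⊢ gs ⟨ xs ⟩⇓* ys

Φ⇓ : ∀ e {B x y} → Φ⟨ e ⟩^ B ⟨ x ⟩↓= y → B ⊢ decode e ⟨ x ∷ [] ⟩⇓ y
Φ⇓ _ (k , e) = halts k e

⇓Φ : ∀ e {B x y} → B ⊢ decode e ⟨ x ∷ [] ⟩⇓ y → Φ⟨ e ⟩^ B ⟨ x ⟩↓= y
⇓Φ _ (halts k e) = k , e

⇓-deterministic : ∀ {O c xs y y'} → O ⊢ c ⟨ xs ⟩⇓ y → O ⊢ c ⟨ xs ⟩⇓ y' → y ≡ y'
⇓-deterministic {O} {c} {xs} (halts k e) (halts k' e') = eval-deterministic O c xs k k' e e'

bind-≡ : ∀ {A B : Set} {m : Maybe A} {f : A → Maybe B} {x y} → m ≡ just x → f x ≡ just y → (m >>= f) ≡ just y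
bind-≡ refl e = e

zer⇓ : ∀ {O xs} → O ⊢ zer ⟨ xs ⟩⇓ 0
zer⇓ = halts 1 refl

sc⇓ : ∀ {O x xs} → O ⊢ sc ⟨ x ∷ xs ⟩⇓ suc x
sc⇓ = halts 1 refl

proj⇓ : ∀ {O} i xs → O ⊢ proj i ⟨ xs ⟩⇓ nth i xs
proj⇓ i xs = halts 1 refl

orc⇓ : ∀ {O x xs} → O ⊢ orc ⟨ x ∷ xs ⟩⇓ (if O x then 1 else 0)
orc⇓ = halts 1 refl

nil⇓ : ∀ {O xs} → O ⊢ [] ⟨ xs ⟩⇓* []
nil⇓ = halts* 0 refl

cons⇓ : ∀ {O g gs xs y ys} → O ⊢ g ⟨ xs ⟩⇓ y → O ⊢ gs ⟨ xs ⟩⇓* ys → O ⊢ g ∷ gs ⟨ xs ⟩⇓* (y ∷ ys)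
cons⇓ {O} {g} {gs} {xs} (halts k e) (halts* k' e') =
  halts* (suc (k ⊔ k')) $ bind-≡ (eval-mono O g xs (m≤m⊔n k k') e) (bind-≡ (evalList-mono O gs xs (m≤n⊔m k k') e') refl)

comp⇓ : ∀ {O f gs xs ys y} → O ⊢ gs ⟨ xs ⟩⇓* ys → O ⊢ f ⟨ ys ⟩⇓ y → O ⊢ comp f gs ⟨ xs ⟩⇓ y
comp⇓ {O} {f} {gs} {xs} {ys} (halts* k e) (halts k' e') =
  halts (suc (k ⊔ k')) $ bind-≡ (evalList-mono O gs xs (m≤m⊔n k k') e) (eval-mono O f ys (m≤n⊔m k k') e')

comp₁⇓ : ∀ {O f g xs a y} → O ⊢ g ⟨ xs ⟩⇓ a → O ⊢ f ⟨ a ∷ [] ⟩⇓ y → O ⊢ comp f (g ∷ []) ⟨ xs ⟩⇓ y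
comp₁⇓ p q = comp⇓ (cons⇓ p nil⇓) q

comp₂⇓ : ∀ {O f g h xs a b y} → O ⊢ g ⟨ xs ⟩⇓ a → O ⊢ h ⟨ xs ⟩⇓ b → O ⊢ f ⟨ a ∷ b ∷ [] ⟩⇓ y →
         O ⊢ comp f (g ∷ h ∷ []) ⟨ xs ⟩⇓ y
comp₂⇓ p p' q = comp⇓ (cons⇓ p (cons⇓ p' nil⇓)) q

comp₁-inv : ∀ {O f g xs w} → O ⊢ comp f (g ∷ []) ⟨ xs ⟩⇓ w → ∃[ y ] (O ⊢ g ⟨ xs ⟩⇓ y × O ⊢ f ⟨ y ∷ [] ⟩⇓ w)
comp₁-inv {O} {f} {g} {xs} (halts (suc k) eq) with bind-just (evalList k O (g ∷ []) xs) _ eq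
comp₁-inv {O} {f} {g} {xs} (halts (suc (suc k)) eq) | ys , e₁ , e₂ with bind-just (eval k O g xs) _ e₁
... | y , e₃ , refl = y , halts k e₃ , halts (suc k) e₂

natrec : {X : Set} → X → (ℕ → X → X) → ℕ → X
natrec z s zero = z
natrec z s (suc n) = s n (natrec z s n)

natrec-shift : ∀ {X : Set} (f : X → X) s n → natrec s (λ _ → f) (suc n) ≡ natrec (f s) (λ _ → f) n
natrec-shift f s zero = refl
natrec-shift f s (suc n) = cong f (natrec-shift f s n)

natrec-cong : ∀ {X : Set} (z : X) {s s'} → (∀ m r → s m r ≡ s' m r) → ∀ n → natrec z s n ≡ natrec z s' n
natrec-cong z eq zero = refl
natrec-cong z {s} {s'} eq (suc n) = trans (eq n (natrec z s n)) (cong (s' n) (natrec-cong z eq n))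

prec⇓ : ∀ {O f g xs z} (s : ℕ → ℕ → ℕ) → O ⊢ f ⟨ xs ⟩⇓ z → (∀ n r → O ⊢ g ⟨ n ∷ r ∷ xs ⟩⇓ s n r) →
        ∀ n → O ⊢ prec f g ⟨ n ∷ xs ⟩⇓ natrec z s n
prec⇓ s (halts k e) G zero = halts (suc k) e
prec⇓ {O} {f} {g} {xs} {z} s F G (suc n) with prec⇓ s F G n | G n (natrec z s n)
... | halts k e | halts k' e' =
  halts (suc (k ⊔ k')) $ bind-≡ (eval-mono O (prec f g) (n ∷ xs) (m≤m⊔n k k') e)
                        (eval-mono O g (n ∷ natrec z s n ∷ xs) (m≤n⊔m k k') e')

search-hit : ∀ k O f xs n → eval k O f (n ∷ xs) ≡ just 0 → search (suc k) O f xs n ≡ just n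
search-hit k O f xs n e rewrite e = refl

search-skip : ∀ k O f xs n {w} → eval k O f (n ∷ xs) ≡ just (suc w) → search (suc k) O f xs n ≡ search k O f xs (suc n)
search-skip k O f xs n e rewrite e = refl

mu⇓ : ∀ {O f xs} n → (∀ z → z < n → ∃[ w ] O ⊢ f ⟨ z ∷ xs ⟩⇓ suc w) → O ⊢ f ⟨ n ∷ xs ⟩⇓ 0 → O ⊢ mu f ⟨ xs ⟩⇓ n
mu⇓ {O} {f} {xs} n below at = let k , e = search-from n 0 (λ z _ q → below z q) at in halts (suc k) e
  where
  search-from : ∀ j z₀ → (∀ z → z₀ ≤ z → z < z₀ + j → ∃[ w ] O ⊢ f ⟨ z ∷ xs ⟩⇓ suc w) →
                O ⊢ f ⟨ z₀ + j ∷ xs ⟩⇓ 0 → ∃[ k ] search k O f xs z₀ ≡ just (z₀ + j)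
  search-from zero z₀ _ (halts k e) rewrite +-identityʳ z₀ = suc k , search-hit k O f xs z₀ e
  search-from (suc j) z₀ H at' with H z₀ ≤-refl (m<m+n z₀ (s≤s z≤n))
  ... | w , halts k₁ e₁
    with search-from j (suc z₀) (λ z p q → H z (≤-trans (n≤1+n z₀) p) (subst (z <_) (sym (+-suc z₀ j)) q))
                     (subst (λ m → O ⊢ f ⟨ m ∷ xs ⟩⇓ 0) (+-suc z₀ j) at')
  ... | k₂ , e₂ =
    suc (k₁ ⊔ k₂) , trans (search-skip (k₁ ⊔ k₂) O f xs z₀ (eval-mono O f (z₀ ∷ xs) (m≤m⊔n k₁ k₂) e₁))
                          (trans (search-mono O f xs (suc z₀) (m≤n⊔m k₁ k₂) e₂) (cong just (sym (+-suc z₀ j))))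

mu-diverges : ∀ {O f xs w} → (∀ z → O ⊢ f ⟨ z ∷ xs ⟩⇓ 1) → O ⊢ mu f ⟨ xs ⟩⇓ w → ⊥
mu-diverges {O} {f} {xs} never (halts (suc k) eq) = go k 0 eq
  where
  go : ∀ k n {w} → search k O f xs n ≡ just w → ⊥
  go (suc k) n eq with eval k O f (n ∷ xs) in e
  ... | just zero with never n
  ...   | halts k' e' with eval-deterministic O f (n ∷ xs) k k' e e'
  ...     | ()
  go (suc k) n eq | just (suc _) = go k (suc n) eq

-- Replace every oracle query by the constant 0, the answer of the empty oracle.
mutual
  strip : Code → Code
  strip zer = zer
  strip sc = sc
  strip (proj i) = proj i
  strip (comp f gs) = comp (strip f) (stripList gs)
  strip (prec f g) = prec (strip f) (strip g)
  strip (mu f) = mu (strip f)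
  strip orc = zer

  stripList : List Code → List Code
  stripList [] = []
  stripList (g ∷ gs) = strip g ∷ stripList gs

mutual
  eval-strip : ∀ k O c xs → eval k O (strip c) xs ≡ eval k emptyOracle c xs
  eval-strip zero O c xs = refl
  eval-strip (suc k) O zer xs = refl
  eval-strip (suc k) O sc xs = refl
  eval-strip (suc k) O (proj i) xs = refl
  eval-strip (suc k) O (comp f gs) xs rewrite evalList-strip k O gs xs with evalList k emptyOracle gs xs
  ... | nothing = refl
  ... | just ys = eval-strip k O f ys
  eval-strip (suc k) O (prec f g) [] = eval-strip k O f []
  eval-strip (suc k) O (prec f g) (zero ∷ xs) = eval-strip k O f xs
  eval-strip (suc k) O (prec f g) (suc n ∷ xs)
    rewrite eval-strip k O (prec f g) (n ∷ xs) with eval k emptyOracle (prec f g) (n ∷ xs)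
  ... | nothing = refl
  ... | just r = eval-strip k O g (n ∷ r ∷ xs)
  eval-strip (suc k) O (mu f) xs = search-strip k O f xs 0
  eval-strip (suc k) O orc xs = refl

  evalList-strip : ∀ k O gs xs → evalList k O (stripList gs) xs ≡ evalList k emptyOracle gs xs
  evalList-strip k O [] xs = refl
  evalList-strip zero O (g ∷ gs) xs = refl
  evalList-strip (suc k) O (g ∷ gs) xs rewrite eval-strip k O g xs | evalList-strip k O gs xs = refl

  search-strip : ∀ k O f xs n → search k O (strip f) xs n ≡ search k emptyOracle f xs n
  search-strip zero O f xs n = refl
  search-strip (suc k) O f xs n rewrite eval-strip k O f (n ∷ xs) with eval k emptyOracle f (n ∷ xs)
  ... | nothing = refl
  ... | just zero = refl
  ... | just (suc _) = search-strip k O f xs (suc n)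

strip⇓ : ∀ {O c xs y} → emptyOracle ⊢ c ⟨ xs ⟩⇓ y → O ⊢ strip c ⟨ xs ⟩⇓ y
strip⇓ {O} {c} {xs} (halts k e) = halts k $ trans (eval-strip k O c xs) e

strip⇓⁻ : ∀ {O c xs y} → O ⊢ strip c ⟨ xs ⟩⇓ y → emptyOracle ⊢ c ⟨ xs ⟩⇓ y
strip⇓⁻ {O} {c} {xs} (halts k e) = halts k $ trans (sym (eval-strip k O c xs)) e

record Prog₁ : Set where
  field
    code : Code
    fun  : Set⊆ℕ → ℕ → ℕ
    correct : ∀ O x → O ⊢ code ⟨ x ∷ [] ⟩⇓ fun O x

record Prog₂ : Set where
  field
    code : Code
    fun  : Set⊆ℕ → ℕ → ℕ → ℕ
    correct : ∀ O x y → O ⊢ code ⟨ x ∷ y ∷ [] ⟩⇓ fun O x y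

data Expr : Set where
  var : ℕ → Expr
  cst : ℕ → Expr
  S   : Expr → Expr
  ap₁ : Prog₁ → Expr → Expr
  ap₂ : Prog₂ → Expr → Expr → Expr

const : ℕ → Code
const zero = zer
const (suc n) = comp sc (const n ∷ [])

compile : Expr → Code
compile (var i) = proj i
compile (cst n) = const n
compile (S e) = comp sc (compile e ∷ [])
compile (ap₁ P e) = comp (Prog₁.code P) (compile e ∷ [])
compile (ap₂ P e e') = comp (Prog₂.code P) (compile e ∷ compile e' ∷ [])

⟦_⟧ : Expr → Set⊆ℕ → List ℕ → ℕ
⟦ var i ⟧ O xs = nth i xs
⟦ cst n ⟧ O xs = n
⟦ S e ⟧ O xs = suc (⟦ e ⟧ O xs)
⟦ ap₁ P e ⟧ O xs = Prog₁.fun P O (⟦ e ⟧ O xs)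
⟦ ap₂ P e e' ⟧ O xs = Prog₂.fun P O (⟦ e ⟧ O xs) (⟦ e' ⟧ O xs)

compile⇓ : ∀ O e xs → O ⊢ compile e ⟨ xs ⟩⇓ ⟦ e ⟧ O xs
compile⇓ O (var i) xs = proj⇓ i xs
compile⇓ O (cst n) xs = const⇓ n
  where
  const⇓ : ∀ n → O ⊢ const n ⟨ xs ⟩⇓ n
  const⇓ zero = zer⇓
  const⇓ (suc n) = comp₁⇓ (const⇓ n) sc⇓
compile⇓ O (S e) xs = comp₁⇓ (compile⇓ O e xs) sc⇓
compile⇓ O (ap₁ P e) xs = comp₁⇓ (compile⇓ O e xs) (Prog₁.correct P O _)
compile⇓ O (ap₂ P e e') xs = comp₂⇓ (compile⇓ O e xs) (compile⇓ O e' xs) (Prog₂.correct P O _ _)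

expr₁ : Expr → Prog₁
expr₁ e = record { code = compile e ; fun = λ O x → ⟦ e ⟧ O (x ∷ []) ; correct = λ O x → compile⇓ O e (x ∷ []) }

expr₂ : Expr → Prog₂
expr₂ e = record { code = compile e ; fun = λ O x y → ⟦ e ⟧ O (x ∷ y ∷ []) ; correct = λ O x y → compile⇓ O e (x ∷ y ∷ []) }

-- Primitive recursion on the first argument, with base case and step given as expressions
-- (the step sees the counter as variable 0 and the previous value as variable 1).
rec₁ : (base step : Expr) → Prog₁
rec₁ b s = record
  { code = prec (compile b) (compile s)
  ; fun = λ O → natrec (⟦ b ⟧ O []) (λ m r → ⟦ s ⟧ O (m ∷ r ∷ []))
  ; correct = λ O → prec⇓ _ (compile⇓ O b []) (λ m r → compile⇓ O s (m ∷ r ∷ [])) }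

rec₂ : (base step : Expr) → Prog₂
rec₂ b s = record
  { code = prec (compile b) (compile s)
  ; fun = λ O n x → natrec (⟦ b ⟧ O (x ∷ [])) (λ m r → ⟦ s ⟧ O (m ∷ r ∷ x ∷ [])) n
  ; correct = λ O n x → prec⇓ _ (compile⇓ O b (x ∷ [])) (λ m r → compile⇓ O s (m ∷ r ∷ x ∷ [])) n }

as₁ : (P : Prog₁) (f : Set⊆ℕ → ℕ → ℕ) → (∀ O x → Prog₁.fun P O x ≡ f O x) → Prog₁
as₁ P f eq = record { code = Prog₁.code P ; fun = f
                    ; correct = λ O x → subst (O ⊢ Prog₁.code P ⟨ x ∷ [] ⟩⇓_) (eq O x) (Prog₁.correct P O x) }

as₂ : (P : Prog₂) (f : Set⊆ℕ → ℕ → ℕ → ℕ) → (∀ O x y → Prog₂.fun P O x y ≡ f O x y) → Prog₂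
as₂ P f eq = record { code = Prog₂.code P ; fun = f
                    ; correct = λ O x y → subst (O ⊢ Prog₂.code P ⟨ x ∷ y ∷ [] ⟩⇓_) (eq O x y) (Prog₂.correct P O x y) }

ADD : Prog₂
ADD = as₂ (rec₂ (var 0) (S (var 1))) (λ _ a b → a + b) (λ _ → adds)
  where
  adds : ∀ a b → natrec b (λ _ r → suc r) a ≡ a + b
  adds zero b = refl
  adds (suc a) b = cong suc (adds a b)

_⊕_ : Expr → Expr → Expr
a ⊕ b = ap₂ ADD a b

MUL : Prog₂
MUL = as₂ (rec₂ (cst 0) (var 2 ⊕ var 1)) (λ _ a b → a * b) (λ _ → multiplies)
  where
  multiplies : ∀ a b → natrec 0 (λ _ r → b + r) a ≡ a * b
  multiplies zero b = refl
  multiplies (suc a) b = cong (b +_) (multiplies a b)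

_⊗_ : Expr → Expr → Expr
a ⊗ b = ap₂ MUL a b

PRED : Prog₁
PRED = as₁ (rec₁ (cst 0) (var 0)) (λ _ a → a ∸ 1) (λ { _ zero → refl ; _ (suc a) → refl })

-- truncated subtraction, by recursion on the subtrahend: b ⊖ a is b ∸ a
MONUS : Prog₂
MONUS = as₂ (rec₂ (var 0) (ap₁ PRED (var 1))) (λ _ a b → b ∸ a) (λ _ → subtracts)
  where
  subtracts : ∀ a b → natrec b (λ _ r → r ∸ 1) a ≡ b ∸ a
  subtracts zero b = refl
  subtracts (suc a) b rewrite subtracts a b = pred[m∸n]≡m∸[1+n] b a

_⊖_ : Expr → Expr → Expr
b ⊖ a = ap₂ MONUS a b

eqᵇ : ℕ → ℕ → ℕ
eqᵇ a b = 1 ∸ ((b ∸ a) + (a ∸ b))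

EQ : Prog₂
EQ = as₂ (expr₂ (cst 1 ⊖ ((var 1 ⊖ var 0) ⊕ (var 0 ⊖ var 1)))) (λ _ → eqᵇ) (λ _ _ _ → refl)

caseOf : ℕ → List (ℕ × ℕ) → ℕ → ℕ
caseOf t [] d = d
caseOf t ((j , x) ∷ bs) d = if t ≡ᵇ j then x else caseOf t bs d

select-ok : ∀ a j x y → eqᵇ a j * x + (1 ∸ eqᵇ a j) * y ≡ (if a ≡ᵇ j then x else y)
select-ok zero zero x y = trans (+-identityʳ (x + 0)) (+-identityʳ x)
select-ok zero (suc j) x y rewrite 0∸n≡0 (j + 0) = +-identityʳ y
select-ok (suc a) zero x y rewrite 0∸n≡0 a = +-identityʳ y
select-ok (suc a) (suc j) x y = select-ok a j x y

caseE : Expr → List (ℕ × Expr) → Expr → Expr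
caseE a [] d = d
caseE a ((j , x) ∷ bs) d = (ap₂ EQ a (cst j) ⊗ x) ⊕ ((cst 1 ⊖ ap₂ EQ a (cst j)) ⊗ caseE a bs d)

caseE-ok : ∀ O xs a bs d →
  ⟦ caseE a bs d ⟧ O xs ≡ caseOf (⟦ a ⟧ O xs) (map (λ { (j , x) → j , ⟦ x ⟧ O xs }) bs) (⟦ d ⟧ O xs)
caseE-ok O xs a [] d = refl
caseE-ok O xs a ((j , x) ∷ bs) d =
  trans (cong (λ v → eqᵇ (⟦ a ⟧ O xs) j * ⟦ x ⟧ O xs + (1 ∸ eqᵇ (⟦ a ⟧ O xs) j) * v) (caseE-ok O xs a bs d))
        (select-ok (⟦ a ⟧ O xs) j (⟦ x ⟧ O xs) _)

-- Pairing is programmed directly from its definition; unpairing needs a search for the diagonal.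
TRI : Prog₁
TRI = as₁ (rec₁ (cst 0) (var 1 ⊕ S (var 0))) (λ _ → tri) (λ _ → triangular)
  where
  triangular : ∀ d → natrec 0 (λ m r → r + suc m) d ≡ tri d
  triangular zero = refl
  triangular (suc d) = cong (_+ suc d) (triangular d)

PAIR : Prog₂
PAIR = expr₂ (ap₁ TRI (var 0 ⊕ var 1) ⊕ var 1)

⟪_,_⟫ : Expr → Expr → Expr
⟪ a , b ⟫ = ap₂ PAIR a b

-- The diagonal a + b of n = pair a b is the least z with n < tri (suc z); found by minimisation.
DIAG : Prog₁
DIAG = record { code = mu (compile beyond) ; fun = λ _ n → unpair₁ n + unpair₂ n ; correct = diag⇓ }
  where
  -- zero exactly when n < tri (suc z), for z = var 0 and n = var 1
  beyond : Expr
  beyond = S (var 1) ⊖ ap₁ TRI (S (var 0))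

  diag⇓ : ∀ O n → O ⊢ mu (compile beyond) ⟨ n ∷ [] ⟩⇓ (unpair₁ n + unpair₂ n)
  diag⇓ O n with unpair n in e
  ... | a , b = mu⇓ (a + b) below (subst (O ⊢ compile beyond ⟨ a + b ∷ n ∷ [] ⟩⇓_) at (compile⇓ O beyond _))
    where
    n≡ : tri (a + b) + b ≡ n
    n≡ = pair-unpair n e
    below : ∀ z → z < a + b → ∃[ w ] O ⊢ compile beyond ⟨ z ∷ n ∷ [] ⟩⇓ suc w
    below z z<d = n ∸ tri (suc z) , subst (O ⊢ compile beyond ⟨ z ∷ n ∷ [] ⟩⇓_) (+-∸-assoc 1 tri≤n) (compile⇓ O beyond _)
      where
      tri≤n : tri (suc z) ≤ n
      tri≤n = ≤-trans (tri-mono z<d) (subst (tri (a + b) ≤_) n≡ (m≤m+n _ b))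
    at : suc n ∸ tri (suc (a + b)) ≡ 0
    at = m≤n⇒m∸n≡0 (subst (λ m → suc m ≤ tri (a + b) + suc (a + b)) n≡
           (subst (_≤ tri (a + b) + suc (a + b)) (+-suc (tri (a + b)) b)
             (+-monoʳ-≤ (tri (a + b)) (s≤s (m≤n+m b a)))))

SND : Prog₁
SND = as₁ (expr₁ (var 0 ⊖ ap₁ TRI (ap₁ DIAG (var 0)))) (λ _ → unpair₂) (λ _ → offset)
  where
  -- the second component is the offset of n from the start of its diagonal
  offset : ∀ n → n ∸ tri (unpair₁ n + unpair₂ n) ≡ unpair₂ n
  offset n with unpair n in e
  ... | a , b = trans (cong (_∸ tri (a + b)) (sym (pair-unpair n e))) (m+n∸m≡n (tri (a + b)) b)

FST : Prog₁
FST = as₁ (expr₁ (ap₁ DIAG (var 0) ⊖ ap₁ SND (var 0))) (λ _ → unpair₁) (λ _ n → m+n∸n≡m (unpair₁ n) (unpair₂ n))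

-- The stripped codes for n are built from those of the components
-- of n, which are smaller than n, so they are computed by course-of-values recursion over code numbers.

record StripData (n c l : ℕ) : Set where
  field
    code≤ : c ≤ n
    list≤ : l ≤ n
    code-ok : ∀ k → n < k → decodeF k c ≡ strip (decodeF k n)
    list-ok : ∀ k → n < k → decodeListF k l ≡ stripList (decodeListF k n)
open StripData

Strips : ℕ → ℕ → Set
Strips n u = StripData n (unpair₁ u) (unpair₂ u)

strips-pair : ∀ {n c l} → StripData n c l → Strips n (pair c l)
strips-pair {c = c} {l} D rewrite unpair-pair c l = D

Table : (ℕ → ℕ) → ℕ → Set
Table T m = ∀ z → z ≤ m → Strips z (T z)

-- The stripped program for the code suc m, whose tag is t and whose body is r, read off the table.
stripNode : (ℕ → ℕ) → (m t r : ℕ) → ℕ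
stripNode T m t r = caseOf t
  ( (2 , suc (pair 2 (pair (unpair₁ (T (unpair₁ r))) (unpair₂ (T (unpair₂ r))))))
  ∷ (3 , suc (pair 3 (pair (unpair₁ (T (unpair₁ r))) (unpair₁ (T (unpair₂ r))))))
  ∷ (4 , suc (pair 4 (unpair₁ (T r))))
  ∷ (5 , 0)
  ∷ [] ) (suc m)

-- The entry for suc m: the stripped program, and the stripped list (head code t, tail code r).
stripEntry : (ℕ → ℕ) → ℕ → ℕ
stripEntry T m = pair (stripNode T m (unpair₁ m) (unpair₂ m))
                      (suc (pair (unpair₁ (T (unpair₁ m))) (unpair₂ (T (unpair₂ m)))))

node≤ : ∀ {m t r a b a' b'} → unpair m ≡ (t , r) → unpair r ≡ (a , b) → a' ≤ a → b' ≤ b → pair t (pair a' b') ≤ m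
node≤ {m} {t} {r} {a} {b} e e₂ p q =
  ≤-trans (pair-mono {t} ≤-refl (pair-mono p q)) (≤-reflexive (trans (cong (pair t) (pair-unpair r e₂)) (pair-unpair m e)))

StrippedCode : ℕ → ℕ → Set
StrippedCode n c = (c ≤ n) × (∀ k → n < k → decodeF k c ≡ strip (decodeF k n))

body≤ˡ : ∀ {m t r} → unpair m ≡ (t , r) → unpair₁ r ≤ m
body≤ˡ {m} {r = r} e = ≤-trans (unpair-≤ˡ r refl) (unpair-≤ʳ m e)

body≤ʳ : ∀ {m t r} → unpair m ≡ (t , r) → unpair₂ r ≤ m
body≤ʳ {m} {r = r} e = ≤-trans (unpair-≤ʳ r refl) (unpair-≤ʳ m e)

compNode-ok : ∀ T m r → unpair m ≡ (2 , r) → Table T m →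
  StrippedCode (suc m) (suc (pair 2 (pair (unpair₁ (T (unpair₁ r))) (unpair₂ (T (unpair₂ r))))))
compNode-ok T m r e H = s≤s (node≤ e refl (code≤ Da) (list≤ Db)) , λ { (suc k) (s≤s k>m) → decoded k k>m }
  where
  a = unpair₁ r ; b = unpair₂ r
  Da = H a (body≤ˡ e) ; Db = H b (body≤ʳ e)
  ca = unpair₁ (T a) ; lb = unpair₂ (T b)
  decoded : ∀ k → m < k → decodeF (suc k) (suc (pair 2 (pair ca lb))) ≡ strip (decodeF (suc k) (suc m))
  decoded k k>m = begin
    decodeF (suc k) (suc (pair 2 (pair ca lb)))
      ≡⟨ decode-comp k (pair 2 (pair ca lb)) (unpair-pair 2 (pair ca lb)) (unpair-pair ca lb) ⟩
    comp (decodeF k ca) (decodeListF k lb)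
      ≡⟨ cong₂ comp (code-ok Da k (≤-<-trans (body≤ˡ e) k>m)) (list-ok Db k (≤-<-trans (body≤ʳ e) k>m)) ⟩
    strip (comp (decodeF k a) (decodeListF k b))
      ≡⟨ cong strip (sym (decode-comp k m e refl)) ⟩
    strip (decodeF (suc k) (suc m)) ∎

precNode-ok : ∀ T m r → unpair m ≡ (3 , r) → Table T m →
  StrippedCode (suc m) (suc (pair 3 (pair (unpair₁ (T (unpair₁ r))) (unpair₁ (T (unpair₂ r))))))
precNode-ok T m r e H = s≤s (node≤ e refl (code≤ Da) (code≤ Db)) , λ { (suc k) (s≤s k>m) → decoded k k>m }
  where
  a = unpair₁ r ; b = unpair₂ r
  Da = H a (body≤ˡ e) ; Db = H b (body≤ʳ e)
  ca = unpair₁ (T a) ; cb = unpair₁ (T b)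
  decoded : ∀ k → m < k → decodeF (suc k) (suc (pair 3 (pair ca cb))) ≡ strip (decodeF (suc k) (suc m))
  decoded k k>m = begin
    decodeF (suc k) (suc (pair 3 (pair ca cb)))
      ≡⟨ decode-prec k (pair 3 (pair ca cb)) (unpair-pair 3 (pair ca cb)) (unpair-pair ca cb) ⟩
    prec (decodeF k ca) (decodeF k cb)
      ≡⟨ cong₂ prec (code-ok Da k (≤-<-trans (body≤ˡ e) k>m)) (code-ok Db k (≤-<-trans (body≤ʳ e) k>m)) ⟩
    strip (prec (decodeF k a) (decodeF k b))
      ≡⟨ cong strip (sym (decode-prec k m e refl)) ⟩
    strip (decodeF (suc k) (suc m)) ∎

muNode-ok : ∀ T m r → unpair m ≡ (4 , r) → Table T m → StrippedCode (suc m) (suc (pair 4 (unpair₁ (T r))))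
muNode-ok T m r e H = s≤s bound , λ { (suc k) (s≤s k>m) → decoded k k>m }
  where
  r≤m = unpair-≤ʳ m e
  Dr = H r r≤m
  cr = unpair₁ (T r)
  bound : pair 4 cr ≤ m
  bound = ≤-trans (pair-mono {4} ≤-refl (code≤ Dr)) (≤-reflexive (pair-unpair m e))
  decoded : ∀ k → m < k → decodeF (suc k) (suc (pair 4 cr)) ≡ strip (decodeF (suc k) (suc m))
  decoded k k>m = begin
    decodeF (suc k) (suc (pair 4 cr))  ≡⟨ decode-mu k (pair 4 cr) (unpair-pair 4 cr) ⟩
    mu (decodeF k cr)                  ≡⟨ cong mu (code-ok Dr k (≤-<-trans r≤m k>m)) ⟩
    strip (mu (decodeF k r))           ≡⟨ cong strip (sym (decode-mu k m e)) ⟩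
    strip (decodeF (suc k) (suc m))    ∎

-- Codes whose tag is not 2–5 decode to sc, proj r or zer, which stripping leaves unchanged.
leaf-ok : ∀ m → (∀ k → strip (decodeF (suc k) (suc m)) ≡ decodeF (suc k) (suc m)) → StrippedCode (suc m) (suc m)
leaf-ok m unchanged = ≤-refl , λ { (suc k) _ → sym (unchanged k) }

stripNode-ok : ∀ T m t r → unpair m ≡ (t , r) → Table T m → StrippedCode (suc m) (stripNode T m t r)
stripNode-ok T m 2 r e H = compNode-ok T m r e H
stripNode-ok T m 3 r e H = precNode-ok T m r e H
stripNode-ok T m 4 r e H = muNode-ok T m r e H
stripNode-ok T m 5 r e H = z≤n , λ { (suc k) _ → sym (cong strip (oracle k)) }
  where
  oracle : ∀ k → decodeF (suc k) (suc m) ≡ orc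
  oracle k rewrite e = refl
stripNode-ok T m 0 r e H = leaf-ok m unchanged
  where
  unchanged : ∀ k → strip (decodeF (suc k) (suc m)) ≡ decodeF (suc k) (suc m)
  unchanged k rewrite e = refl
stripNode-ok T m 1 r e H = leaf-ok m unchanged
  where
  unchanged : ∀ k → strip (decodeF (suc k) (suc m)) ≡ decodeF (suc k) (suc m)
  unchanged k rewrite e = refl
stripNode-ok T m (suc (suc (suc (suc (suc (suc _)))))) r e H = leaf-ok m unchanged
  where
  unchanged : ∀ k → strip (decodeF (suc k) (suc m)) ≡ decodeF (suc k) (suc m)
  unchanged k rewrite e = refl

stripCons-ok : ∀ T m → Table T m →
  let l = suc (pair (unpair₁ (T (unpair₁ m))) (unpair₂ (T (unpair₂ m)))) in
  (l ≤ suc m) × (∀ k → suc m < k → decodeListF k l ≡ stripList (decodeListF k (suc m)))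
stripCons-ok T m H = s≤s (≤-trans (pair-mono (code≤ Dt) (list≤ Dr)) (≤-reflexive (pair-unpair m refl)))
                   , λ { (suc k) (s≤s k>m) → decoded k k>m }
  where
  t = unpair₁ m ; r = unpair₂ m
  t≤m = unpair-≤ˡ m refl ; r≤m = unpair-≤ʳ m refl
  Dt = H t t≤m ; Dr = H r r≤m
  decoded : ∀ k → m < k → decodeListF (suc k) (suc (pair (unpair₁ (T t)) (unpair₂ (T r))))
                          ≡ stripList (decodeListF (suc k) (suc m))
  decoded k k>m rewrite unpair-pair (unpair₁ (T t)) (unpair₂ (T r)) =
    cong₂ _∷_ (code-ok Dt k (≤-<-trans t≤m k>m)) (list-ok Dr k (≤-<-trans r≤m k>m))

stripEntry-ok : ∀ T m → Table T m → Strips (suc m) (stripEntry T m)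
stripEntry-ok T m H = strips-pair (record
  { code≤ = proj₁ node ; list≤ = proj₁ cons ; code-ok = proj₂ node ; list-ok = proj₂ cons })
  where
  node = stripNode-ok T m (unpair₁ m) (unpair₂ m) refl H
  cons = stripCons-ok T m H

-- List codes: 0 is the empty list and suc (pair x xs) is x prepended to xs.
headᶜ tailᶜ : ℕ → ℕ
headᶜ h = unpair₁ (h ∸ 1)
tailᶜ h = unpair₂ (h ∸ 1)

nthᶜ : ℕ → ℕ → ℕ
nthᶜ i h = headᶜ (natrec h (λ _ → tailᶜ) i)

-- Course-of-values recursion: the history after m steps is the list [entry m, …, entry 0],
-- so the entry for z sits at position m ∸ z.
histStep : ℕ → ℕ → ℕ
histStep m h = suc (pair (stripEntry (λ z → nthᶜ (m ∸ z) h) m) h)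

history : ℕ → ℕ
history = natrec 1 histStep

history-ok : ∀ m → Table (λ z → nthᶜ (m ∸ z) (history m)) m
history-ok zero zero _ = record { code≤ = z≤n ; list≤ = z≤n ; code-ok = λ { (suc k) _ → refl } ; list-ok = λ { (suc k) _ → refl } }
history-ok (suc m) z z≤1+m with m≤n⇒m<n∨m≡n z≤1+m
... | inj₂ refl rewrite n∸n≡0 m | unpair-pair (stripEntry (λ z → nthᶜ (m ∸ z) (history m)) m) (history m) =
  stripEntry-ok (λ z → nthᶜ (m ∸ z) (history m)) m (history-ok m)
... | inj₁ (s≤s z≤m) rewrite +-∸-assoc 1 z≤m = subst (Strips z) (sym earlier) (history-ok m z z≤m)
  where
  earlier : nthᶜ (suc (m ∸ z)) (history (suc m)) ≡ nthᶜ (m ∸ z) (history m)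
  earlier rewrite natrec-shift tailᶜ (history (suc m)) (m ∸ z)
                | unpair-pair (stripEntry (λ z → nthᶜ (m ∸ z) (history m)) m) (history m) = refl

stripᶜ : ℕ → ℕ
stripᶜ x = unpair₁ (headᶜ (history x))

stripᶜ-ok : ∀ x → StripData x (stripᶜ x) (unpair₂ (headᶜ (history x)))
stripᶜ-ok x = subst (Strips x) (cong (λ i → nthᶜ i (history x)) (n∸n≡0 x)) (history-ok x x ≤-refl)

decode-stripᶜ : ∀ x k → stripᶜ x < k → decodeF k (stripᶜ x) ≡ strip (decode x)
decode-stripᶜ x k p =
  trans (decodeF-fuel k (suc x) (stripᶜ x) p (s≤s (code≤ (stripᶜ-ok x)))) (code-ok (stripᶜ-ok x) (suc x) ≤-refl)

TAILS : Prog₂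
TAILS = rec₂ (var 0) (ap₁ SND (ap₁ PRED (var 1)))

NTH : Prog₂
NTH = as₂ (expr₂ (ap₁ FST (ap₁ PRED (ap₂ TAILS (var 0) (var 1))))) (λ _ → nthᶜ) (λ _ _ _ → refl)

-- stripNode as an expression in the stage m (variable 0) and the history h (variable 1): the tag and
-- body of suc m, the table entries read from the history, and the stripped nodes built from them.
tagE bodyE : Expr
tagE = ap₁ FST (var 0)
bodyE = ap₁ SND (var 0)

codeAtE listAtE : Expr → Expr
codeAtE z = ap₁ FST (ap₂ NTH (var 0 ⊖ z) (var 1))
listAtE z = ap₁ SND (ap₂ NTH (var 0 ⊖ z) (var 1))

compNodeE precNodeE muNodeE : Expr
compNodeE = S ⟪ cst 2 , ⟪ codeAtE (ap₁ FST bodyE) , listAtE (ap₁ SND bodyE) ⟫ ⟫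
precNodeE = S ⟪ cst 3 , ⟪ codeAtE (ap₁ FST bodyE) , codeAtE (ap₁ SND bodyE) ⟫ ⟫
muNodeE = S ⟪ cst 4 , codeAtE bodyE ⟫

nodeBranchesE : List (ℕ × Expr)
nodeBranchesE = (2 , compNodeE) ∷ (3 , precNodeE) ∷ (4 , muNodeE) ∷ (5 , cst 0) ∷ []

stripNodeE : Expr
stripNodeE = caseE tagE nodeBranchesE (S (var 0))

stripNodeE-ok : ∀ O m h → ⟦ stripNodeE ⟧ O (m ∷ h ∷ []) ≡ stripNode (λ z → nthᶜ (m ∸ z) h) m (unpair₁ m) (unpair₂ m)
stripNodeE-ok O m h = caseE-ok O (m ∷ h ∷ []) tagE nodeBranchesE (S (var 0))

histStepE : Expr
histStepE = S ⟪ ⟪ stripNodeE , S ⟪ codeAtE tagE , listAtE bodyE ⟫ ⟫ , var 1 ⟫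

histStepE-ok : ∀ O m h → ⟦ histStepE ⟧ O (m ∷ h ∷ []) ≡ histStep m h
histStepE-ok O m h rewrite stripNodeE-ok O m h = refl

HIST : Prog₁
HIST = as₁ (rec₁ (cst 1) histStepE) (λ _ → history) (λ O → natrec-cong 1 (histStepE-ok O))

STRIP : Prog₁
STRIP = as₁ (expr₁ (ap₁ FST (ap₁ FST (ap₁ PRED (ap₁ HIST (var 0)))))) (λ _ → stripᶜ) (λ _ _ → refl)

χ : Bool → ℕ
χ b = if b then 1 else 0

ORC : Prog₁
ORC = record { code = orc ; fun = λ O x → χ (O x) ; correct = λ O x → orc⇓ }

ODD : Prog₁
ODD = as₁ (rec₁ (cst 0) (cst 1 ⊖ var 1)) (λ _ n → χ (odd n)) (λ _ → parity)
  where
  flip-flip : ∀ b → 1 ∸ (1 ∸ χ b) ≡ χ b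
  flip-flip true = refl
  flip-flip false = refl
  parity : ∀ n → natrec 0 (λ _ r → 1 ∸ r) n ≡ χ (odd n)
  parity zero = refl
  parity (suc zero) = refl
  parity (suc (suc n)) rewrite parity n = flip-flip (odd n)

HALF : Prog₁
HALF = as₁ (rec₁ (cst 0) (var 1 ⊕ ap₁ ODD (var 0))) (λ _ → half) (λ _ → halving)
  where
  odd-suc : ∀ n → odd (suc n) ≡ not (odd n)
  odd-suc zero = refl
  odd-suc (suc zero) = refl
  odd-suc (suc (suc n)) = odd-suc n
  one-odd : ∀ n → χ (odd n) + χ (odd (suc n)) ≡ 1
  one-odd n rewrite odd-suc n with odd n
  ... | true = refl
  ... | false = refl
  halving : ∀ n → natrec 0 (λ m r → r + χ (odd m)) n ≡ half n
  halving zero = refl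
  halving (suc zero) = refl
  halving (suc (suc n)) = begin
    natrec 0 _ n + χ (odd n) + χ (odd (suc n))   ≡⟨ +-assoc (natrec 0 _ n) _ _ ⟩
    natrec 0 _ n + (χ (odd n) + χ (odd (suc n))) ≡⟨ cong₂ _+_ (halving n) (one-odd n) ⟩
    half n + 1                                   ≡⟨ +-comm (half n) 1 ⟩
    suc (half n)                                 ∎

BIT : Prog₂
BIT = as₂ (expr₂ (ap₁ ODD (ap₂ (rec₂ (var 0) (ap₁ HALF (var 1))) (var 0) (var 1)))) (λ _ i b → χ (bit b i)) (λ _ → halved)
  where
  halved : ∀ i b → χ (odd (natrec b (λ _ → half) i)) ≡ χ (bit b i)
  halved zero b = refl
  halved (suc i) b rewrite natrec-shift half b i = halved i (half b)

-- The row index of a list of numbers is computed by a loop over the list code, on states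
-- pair rest (pair acc pw): the head x of rest contributes χ (O x) · pw to acc, and pw doubles; once the
-- list is exhausted (rest = 0) the accumulator no longer changes.
rowStep : Set⊆ℕ → ℕ → ℕ
rowStep O s = pair (tailᶜ rest) (pair (caseOf rest ((0 , acc) ∷ []) (acc + χ (O (headᶜ rest)) * pw)) (pw + pw))
  where
  rest acc pw : ℕ
  rest = unpair₁ s
  acc = unpair₁ (unpair₂ s)
  pw = unpair₂ (unpair₂ s)

rowStepE : Expr → Expr
rowStepE s = ⟪ ap₁ SND (ap₁ PRED rest) , ⟪ caseE rest ((0 , acc) ∷ []) (acc ⊕ (ap₁ ORC (ap₁ FST (ap₁ PRED rest)) ⊗ pw)) , pw ⊕ pw ⟫ ⟫
  where
  rest acc pw : Expr
  rest = ap₁ FST s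
  acc = ap₁ FST (ap₁ SND s)
  pw = ap₁ SND (ap₁ SND s)

rowStepE-ok : ∀ O s xs → ⟦ rowStepE s ⟧ O xs ≡ rowStep O (⟦ s ⟧ O xs)
rowStepE-ok O s xs rewrite caseE-ok O xs (ap₁ FST s) ((0 , ap₁ FST (ap₁ SND s)) ∷ [])
                      (ap₁ FST (ap₁ SND s) ⊕ (ap₁ ORC (ap₁ FST (ap₁ PRED (ap₁ FST s))) ⊗ ap₁ SND (ap₁ SND s))) = refl

decodeNatListF-0 : ∀ k → decodeNatListF k 0 ≡ []
decodeNatListF-0 zero = refl
decodeNatListF-0 (suc k) = refl

row-algebra : ∀ acc b pw R → acc + b * pw + (pw + pw) * R ≡ acc + pw * (b + 2 * R)
row-algebra = solve-∀

-- After k steps from pair rest (pair acc pw), the accumulator holds acc + pw · (row index of the list coded by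
-- rest, decoded with fuel k); the fuel of the loop and of the decoding run in lockstep.
rowLoop : ∀ O k rest acc pw →
  unpair₁ (unpair₂ (natrec (pair rest (pair acc pw)) (λ _ → rowStep O) k)) ≡ acc + pw * rowIndex O (decodeNatListF k rest)
rowLoop O zero rest acc pw rewrite unpair-pair rest (pair acc pw) | unpair-pair acc pw | *-zeroʳ pw = sym (+-identityʳ acc)
rowLoop O (suc k) zero acc pw
  rewrite natrec-shift (rowStep O) (pair 0 (pair acc pw)) k | unpair-pair 0 (pair acc pw) | unpair-pair acc pw
        | rowLoop O k 0 acc (pw + pw) | *-zeroʳ pw | decodeNatListF-0 k | *-zeroʳ (pw + pw) = refl
rowLoop O (suc k) (suc m) acc pw
  rewrite natrec-shift (rowStep O) (pair (suc m) (pair acc pw)) k | unpair-pair (suc m) (pair acc pw) | unpair-pair acc pw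
        | rowLoop O k (unpair₂ m) (acc + χ (O (unpair₁ m)) * pw) (pw + pw) =
  row-algebra acc (χ (O (unpair₁ m))) pw (rowIndex O (decodeNatListF k (unpair₂ m)))

-- ROW runs the loop l + 1 times on the list code l, which is enough fuel for decoding it.
ROW : Prog₁
ROW = as₁ (expr₁ (ap₁ FST (ap₁ SND (ap₂ LOOP (S (var 0)) (var 0))))) (λ O l → rowIndex O (decodeNatList l))
          (λ O l → trans (rowLoop O (suc l) l 0 1) (+-identityʳ (rowIndex O (decodeNatList l))))
  where
  LOOP : Prog₂
  LOOP = as₂ (rec₂ ⟪ var 0 , ⟪ cst 0 , cst 1 ⟫ ⟫ (rowStepE (var 1)))
             (λ O n l → natrec (pair l (pair 0 1)) (λ _ → rowStep O) n)
             (λ O n l → natrec-cong (pair l (pair 0 1)) (λ m r → rowStepE-ok O (var 1) (m ∷ r ∷ l ∷ [])) n)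

SatTT-unfold : ∀ A c → SatTT A c ≡ bit (unpair₂ c) (rowIndex A (decodeNatList (unpair₁ c)))
SatTT-unfold A c with unpair c
... | l , t = refl

SAT : Prog₁
SAT = as₁ (expr₁ (ap₂ BIT (ap₁ ROW (ap₁ FST (var 0))) (ap₁ SND (var 0)))) (λ O c → χ (SatTT O c))
          (λ O c → cong χ (sym (SatTT-unfold O c)))

unsatE : Expr
unsatE = cst 1 ⊖ ap₁ SAT (var 1)

Evaluator : Code
Evaluator = mu (compile unsatE)

Evaluator-halts : ∀ O c → SatTT O c ≡ true → O ⊢ Evaluator ⟨ c ∷ [] ⟩⇓ 0
Evaluator-halts O c sat =
  mu⇓ 0 (λ _ ()) (subst (O ⊢ compile unsatE ⟨ 0 ∷ c ∷ [] ⟩⇓_) (cong (λ b → 1 ∸ χ b) sat) (compile⇓ O unsatE _))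

Evaluator-diverges : ∀ O c {w} → SatTT O c ≡ false → O ⊢ Evaluator ⟨ c ∷ [] ⟩⇓ w → ⊥
Evaluator-diverges O c unsat = mu-diverges λ z →
  subst (O ⊢ compile unsatE ⟨ z ∷ c ∷ [] ⟩⇓_) (cong (λ b → 1 ∸ χ b) unsat) (compile⇓ O unsatE _)

-- A tt-condition only queries numbers below its own code, so restricting the oracle there changes nothing.
↾-below : ∀ A {c x} → x ≤ c → (A ↾ c) x ≡ A x
↾-below A {c} {x} x≤c rewrite Equivalence.to T-≡ (≤⇒≤ᵇ x≤c) = refl

rowIndex-↾ : ∀ A c k l → l ≤ c → rowIndex (A ↾ c) (decodeNatListF k l) ≡ rowIndex A (decodeNatListF k l)
rowIndex-↾ A c zero l p = refl
rowIndex-↾ A c (suc k) zero p = refl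
rowIndex-↾ A c (suc k) (suc m) p =
  cong₂ (λ b R → χ b + 2 * R) (↾-below A (≤-trans (unpair-≤ˡ m refl) m≤c)) (rowIndex-↾ A c k (unpair₂ m) (≤-trans (unpair-≤ʳ m refl) m≤c))
  where
  m≤c = ≤-trans (n≤1+n m) p

SatTT-↾ : ∀ A c → SatTT (A ↾ c) c ≡ SatTT A c
SatTT-↾ A c = begin
  SatTT (A ↾ c) c                                               ≡⟨ SatTT-unfold (A ↾ c) c ⟩
  bit (unpair₂ c) (rowIndex (A ↾ c) (decodeNatList (unpair₁ c))) ≡⟨ cong (bit (unpair₂ c)) (rowIndex-↾ A c (suc (unpair₁ c)) (unpair₁ c) (unpair-≤ˡ c refl)) ⟩
  bit (unpair₂ c) (rowIndex A (decodeNatList (unpair₁ c)))       ≡⟨ sym (SatTT-unfold A c) ⟩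
  SatTT A c                                                     ∎

expr-computable : (F : Expr) → Computable (λ x → ⟦ F ⟧ emptyOracle (x ∷ []))
expr-computable F = ⌜ compile F ⌝ , λ x →
  ⇓Φ ⌜ compile F ⌝ (subst (λ c → emptyOracle ⊢ c ⟨ x ∷ [] ⟩⇓ ⟦ F ⟧ emptyOracle (x ∷ [])) (sym (decode-⌜⌝ (compile F)))
                           (compile⇓ emptyOracle F (x ∷ [])))

redProg : ℕ → Code
redProg x = comp Evaluator (strip (decode x) ∷ [])

redProg-halts : ∀ A x v → φ⟨ x ⟩⟨ x ⟩↓= v → SatTT A v ≡ true → (A ↾ v) ⊢ redProg x ⟨ x ∷ [] ⟩⇓ 0
redProg-halts A x v φxx sat = comp₁⇓ (strip⇓ (Φ⇓ x φxx)) (Evaluator-halts (A ↾ v) v (trans (SatTT-↾ A v) sat))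

redProg-halts⁻ : ∀ A x v {w} → φ⟨ x ⟩⟨ x ⟩↓= v → (A ↾ v) ⊢ redProg x ⟨ x ∷ [] ⟩⇓ w → SatTT A v ≡ true
redProg-halts⁻ A x v φxx halt with comp₁-inv halt
... | y , run , evaluated with ⇓-deterministic (strip⇓⁻ run) (Φ⇓ x φxx)
... | refl with SatTT (A ↾ v) v in sat
... | true = trans (sym (SatTT-↾ A v)) sat
... | false = ⊥-elim (Evaluator-diverges (A ↾ v) v sat evaluated)

-- The reduction, for any code number evalCode of the evaluator.  (Taking the code as a parameter keeps the
-- type checker from ever unfolding the numeral ⌜ Evaluator ⌝, which is astronomically large.)
module Reduction (evalCode : ℕ) (decodeF-evalCode : ∀ k → evalCode < k → decodeF k evalCode ≡ Evaluator) where

  redIndex : ℕ → ℕ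
  redIndex x = suc (pair 2 (pair evalCode (suc (pair (stripᶜ x) 0))))

  decode-redIndex : ∀ x → decode (redIndex x) ≡ redProg x
  decode-redIndex x = begin
    decodeF (suc N) (suc M)                   ≡⟨ decode-comp N M (unpair-pair 2 (pair E L)) (unpair-pair E L) ⟩
    comp (decodeF N E) (decodeListF N L)      ≡⟨ cong₂ comp (decodeF-evalCode N E<N) inner ⟩
    comp Evaluator (strip (decode x) ∷ [])    ∎
    where
    E = evalCode
    s = stripᶜ x
    L = suc (pair s 0)
    M = pair 2 (pair E L)
    N = suc M
    E<N : E < N
    E<N = s≤s (≤-trans (pair-≥ˡ E L) (pair-≥ʳ 2 _))
    s<M : s < M
    s<M = ≤-trans (s≤s (pair-≥ˡ s 0)) (≤-trans (pair-≥ʳ E L) (pair-≥ʳ 2 _))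
    inner : decodeListF N L ≡ strip (decode x) ∷ []
    inner rewrite unpair-pair s 0 = cong₂ _∷_ (decode-stripᶜ x M s<M) (decodeListF-0 M)

  reduction : ℕ → ℕ
  reduction x = triple (redIndex x) x x

  reduction-computable : Computable reduction
  reduction-computable =
    expr-computable ⟪ S ⟪ cst 2 , ⟪ cst evalCode , S ⟪ ap₁ STRIP (var 0) , cst 0 ⟫ ⟫ ⟫ , ⟪ var 0 , var 0 ⟫ ⟫

  -- Injective already in its last component.
  reduction-injective : Injective _≡_ _≡_ reduction
  reduction-injective {x} {y} eq = proj₂ (proj₂ (triple-injective {redIndex x} {x} {x} {redIndex y} {y} {y} eq))

  reduction-sound : ∀ A x → (A ₜₜ) x → (A ^b₀) (reduction x)
  reduction-sound A x (v , φxx , sat) =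
    redIndex x , x , x , refl , v , φxx ,
    0 , ⇓Φ (redIndex x) (subst (λ c → (A ↾ v) ⊢ c ⟨ x ∷ [] ⟩⇓ 0) (sym (decode-redIndex x)) (redProg-halts A x v φxx sat))

  reduction-complete : ∀ A x → (A ^b₀) (reduction x) → (A ₜₜ) x
  reduction-complete A x (e , i , j , eq , v , φij , w , halt) with triple-injective {redIndex x} {x} {x} {e} {i} {j} eq
  ... | refl , refl , refl =
    v , φij , redProg-halts⁻ A x v φij (subst (λ c → (A ↾ v) ⊢ c ⟨ x ∷ [] ⟩⇓ w) (decode-redIndex x) (Φ⇓ (redIndex x) halt))

  reduces : (A : Set⊆ℕ) → (A ₜₜ) ≤₁ (A ^b₀)
  reduces A = reduction , reduction-computable , reduction-injective ,
              λ x → reduction-sound A x , reduction-complete A x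

mainTheorem17 : (A : Set⊆ℕ) → (A ₜₜ) ≤₁ (A ^b₀)
mainTheorem17 = Reduction.reduces ⌜ Evaluator ⌝ (λ k → decodeF-⌜⌝ k Evaluator)
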